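{- Let $q$ be an odd prime power and let $\mathcal{L}'''$, $G$, $K$ be as in the context. Then $K$ contains a subgroup of order $q^2(q+1)$ which leaves $\mathcal{L}'''$ invariant.
   Context: Let $q$ be a power of an odd prime, with homogeneous coordinates $(X_1,X_2,X_3,X_4)$ on $\mathrm{PG}(3,q)$. Fix a non-square $\omega\in\mathrm{GF}(q)$. For $\lambda\in\mathrm{GF}(q)$ let $\mathcal{E}_\lambda$ be the elliptic quadric $X_1^2-\omega X_2^2+\lambda X_4^2+X_3X_4=0$, and let $\mathcal{E}=\mathcal{E}_0$, with quadratic form $Q(X)=X_1^2-\omega X_2^2+X_3X_4$. Let $G=\mathrm{P}\Omega^-(4,q)$ be the commutator subgroup of the stabilizer of $\mathcal{E}$ in $\mathrm{PGL}(4,q)$, let $U_3=(0,0,1,0)\in\mathcal{E}$ and let $K$ be the stabilizer of $U_3$ in $G$. Let $O_s$ (resp. $O_n$) be the set of points $X$ with $Q(X)$ a non-zero square (resp. non-square). On a line meeting $\mathcal{E}$ in exactly one point (tangent line), the $q$ points off $\mathcal{E}$ all lie in $O_s$ or all in $O_n$; let $\mathcal{L}_0$ be the set of tangent lines whose $q$ points off $\mathcal{E}$ lie in $O_s$. Let $\mathcal{L}_2$ be the set of lines meeting $\mathcal{E}$ in $2$ points and $\mathcal{L}_3$ the set of lines disjoint from $\mathcal{E}$. Let $\pi$ be the plane $X_4=0$, and $\pi_0$ (resp. $\pi_1$) the set of points $X\in\pi$ with $Q(X)$ a non-zero square (resp. a non-square). Fix a non-zero square $\lambda_1$ and a non-square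 $\lambda_2$ in $\mathrm{GF}(q)$. Define $\mathcal{T}_{10}=\{r\in\mathcal{L}_2: |r\cap\mathcal{E}_{\lambda_1}|=1,\ |r\cap\pi_0|=1\}$, $\mathcal{T}_{11}=\{r\in\mathcal{L}_3: |r\cap\mathcal{E}_{\lambda_1}|=1,\ |r\cap\pi_1|=1\}$, $\mathcal{T}_{20}=\{r\in\mathcal{L}_3: |r\cap\mathcal{E}_{\lambda_2}|=1,\ |r\cap\pi_0|=1\}$, $\mathcal{T}_{21}=\{r\in\mathcal{L}_2: |r\cap\mathcal{E}_{\lambda_2}|=1,\ |r\cap\pi_1|=1\}$, $\mathcal{A}=\mathcal{T}_{11}\cup\mathcal{T}_{20}$, $\mathcal{B}=\mathcal{T}_{10}\cup\mathcal{T}_{21}$, $\mathcal{L}'=\mathcal{L}_0\cup\mathcal{L}_3$ and $\mathcal{L}'''=(\mathcal{L}'\setminus\mathcal{A})\cup\mathcal{B}$ (a Cameron--Liebler line class with parameter $(q^2+1)/2$). -}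

module Defs where

open import Level using (0ℓ)
open import Data.Nat using (ℕ; _≡ᵇ_) renaming (_+_ to _+ℕ_; _*_ to _*ℕ_)
open import Data.Bool using (Bool; true; false; _∧_; _∨_; not; if_then_else_)
import Data.Fin
open import Data.Fin using (Fin; zero; suc)
open import Data.List using (List; []; _∷_; length; foldr)
open import Data.Bool.ListAction using (any)
open import Data.List.Membership.Propositional using (_∈_)
open import Data.List.Relation.Unary.Unique.Propositional using (Unique)
open import Data.List.Relation.Unary.AllPairs using (AllPairs)
open import Data.List.Relation.Unary.All using (All)
open import Data.Product using (Σ; _×_; _,_; ∃)
open import Data.Sum using (_⊎_)
open import Relation.Nullary using (¬_; does)
open import Relation.Binary.Definitions using (DecidableEquality)
open import Relation.Binary.PropositionalEquality using (_≡_)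
open import Algebra.Structures using (IsCommutativeRing)

record FiniteField : Set₁ where
  field
    Carrier  : Set
    _≟_      : DecidableEquality Carrier
    _+_ _*_  : Carrier → Carrier → Carrier
    -_       : Carrier → Carrier
    0# 1#    : Carrier
    isCommutativeRing : IsCommutativeRing _≡_ _+_ _*_ -_ 0# 1#
    1≢0      : ¬ (1# ≡ 0#)
    _⁻¹      : Carrier → Carrier
    inverse  : ∀ x → ¬ (x ≡ 0#) → x * (x ⁻¹) ≡ 1#
    elements : List Carrier
    complete : ∀ x → x ∈ elements
    unique   : Unique elements

  infixl 7 _*_
  infixl 6 _+_

  order : ℕ
  order = length elements

  -- odd characteristic (equivalently, q is a power of an odd prime)
  OddCharacteristic : Set
  OddCharacteristic = ¬ (1# + 1# ≡ 0#)

module _ (𝔽 : FiniteField) where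
  open FiniteField 𝔽

  isZero : Carrier → Bool
  isZero x = does (x ≟ 0#)

  isSquare : Carrier → Bool
  isSquare x = any (λ y → does ((y * y) ≟ x)) elements

  isNzSquare : Carrier → Bool
  isNzSquare x = not (isZero x) ∧ isSquare x

  isNonSquare : Carrier → Bool
  isNonSquare x = not (isSquare x)

  -- Vectors of GF(q)^4 (homogeneous coordinates X₁..X₄ = indices 0..3)
  Vec4 : Set
  Vec4 = Fin 4 → Carrier

  X₁ X₂ X₃ X₄ : Vec4 → Carrier
  X₁ x = x zero
  X₂ x = x (suc zero)
  X₃ x = x (suc (suc zero))
  X₄ x = x (suc (suc (suc zero)))

  NonZeroVec : Vec4 → Set
  NonZeroVec x = ¬ (∀ i → x i ≡ 0#)

  _+v_ : Vec4 → Vec4 → Vec4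
  (u +v v) i = u i + v i

  _·v_ : Carrier → Vec4 → Vec4
  (t ·v v) i = t * v i

  _∝v_ : Vec4 → Vec4 → Set
  x ∝v y = Σ Carrier λ c → ¬ (c ≡ 0#) × (∀ i → y i ≡ c * x i)

  U₃ : Vec4
  U₃ zero = 0#
  U₃ (suc zero) = 0#
  U₃ (suc (suc zero)) = 1#
  U₃ (suc (suc (suc zero))) = 0#

  -- Lines of PG(3,q): spanned by two linearly independent vectors u, v.
  Independent : Vec4 → Vec4 → Set
  Independent u v = ∀ a b → (∀ i → a * u i + b * v i ≡ 0#) → (a ≡ 0#) × (b ≡ 0#)

  -- the q+1 points of the line ⟨u,v⟩ are ⟨u + t v⟩ (t ∈ GF(q)) and ⟨v⟩;
  -- number of them satisfying a (projectively invariant) point predicate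
  -- number of elements of a list satisfying a Boolean test
  countB : {A : Set} → (A → Bool) → List A → ℕ
  countB P [] = 0
  countB P (a ∷ as) = (if P a then 1 else 0) +ℕ countB P as

  countOnLine : (Vec4 → Bool) → Vec4 → Vec4 → ℕ
  countOnLine P u v =
    (if P v then 1 else 0) +ℕ countB (λ t → P (u +v (t ·v v))) elements

  LinePred : Set₁
  LinePred = Vec4 → Vec4 → Set

  Mat4 : Set
  Mat4 = Fin 4 → Fin 4 → Carrier

  sum4 : (Fin 4 → Carrier) → Carrier
  sum4 f = f zero + f (suc zero) + f (suc (suc zero)) + f (suc (suc (suc zero)))

  _·m_ : Mat4 → Vec4 → Vec4
  (M ·m x) i = sum4 (λ j → M i j * x j)

  _⊗_ : Mat4 → Mat4 → Mat4
  (A ⊗ B) i k = sum4 (λ j → A i j * B j k)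

  idM : Mat4
  idM i j = if does (i Data.Fin.≟ j) then 1# else 0#

  _≡m_ : Mat4 → Mat4 → Set
  A ≡m B = ∀ i j → A i j ≡ B i j

  -- equality in PGL(4,q): equal up to a non-zero scalar
  _∝m_ : Mat4 → Mat4 → Set
  A ∝m B = Σ Carrier λ c → ¬ (c ≡ 0#) × (∀ i j → B i j ≡ c * A i j)

  LeavesInvariant : Mat4 → LinePred → Set
  LeavesInvariant M 𝓛 = ∀ u v → Independent u v → 𝓛 u v → 𝓛 (M ·m u) (M ·m v)

  module Setting (ω λ₁ λ₂ : Carrier) where

    Q : Vec4 → Carrier
    Q x = X₁ x * X₁ x + - (ω * (X₂ x * X₂ x)) + X₃ x * X₄ x

    onEλ : Carrier → Vec4 → Bool
    onEλ λ' x = isZero (Q x + λ' * (X₄ x * X₄ x))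

    onE : Vec4 → Bool
    onE x = isZero (Q x)

    inOs inOn : Vec4 → Bool
    inOs x = isNzSquare (Q x)
    inOn x = isNonSquare (Q x)

    inπ₀ inπ₁ : Vec4 → Bool
    inπ₀ x = isZero (X₄ x) ∧ isNzSquare (Q x)
    inπ₁ x = isZero (X₄ x) ∧ isNonSquare (Q x)

    𝓛₀ 𝓛₂ 𝓛₃ : LinePred
    -- tangent line whose q points off E all lie in O_s
    𝓛₀ u v = (countOnLine onE u v ≡ 1) × (countOnLine inOs u v ≡ order)
    𝓛₂ u v = countOnLine onE u v ≡ 2
    𝓛₃ u v = countOnLine onE u v ≡ 0

    𝓣₁₀ 𝓣₁₁ 𝓣₂₀ 𝓣₂₁ : LinePred
    𝓣₁₀ u v = 𝓛₂ u v × (countOnLine (onEλ λ₁) u v ≡ 1) × (countOnLine inπ₀ u v ≡ 1)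
    𝓣₁₁ u v = 𝓛₃ u v × (countOnLine (onEλ λ₁) u v ≡ 1) × (countOnLine inπ₁ u v ≡ 1)
    𝓣₂₀ u v = 𝓛₃ u v × (countOnLine (onEλ λ₂) u v ≡ 1) × (countOnLine inπ₀ u v ≡ 1)
    𝓣₂₁ u v = 𝓛₂ u v × (countOnLine (onEλ λ₂) u v ≡ 1) × (countOnLine inπ₁ u v ≡ 1)

    𝓐 𝓑 𝓛′ 𝓛‴ : LinePred
    𝓐 u v = 𝓣₁₁ u v ⊎ 𝓣₂₀ u v
    𝓑 u v = 𝓣₁₀ u v ⊎ 𝓣₂₁ u v
    𝓛′ u v = 𝓛₀ u v ⊎ 𝓛₃ u v
    𝓛‴ u v = (𝓛′ u v × ¬ 𝓐 u v) ⊎ 𝓑 u v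

    record StabE : Set where
      field
        mat     : Mat4
        inv     : Mat4
        rinv    : (mat ⊗ inv) ≡m idM
        linv    : (inv ⊗ mat) ≡m idM
        preserv : ∀ x → NonZeroVec x → onE x ≡ true → onE (mat ·m x) ≡ true

    commutator : StabE → StabE → Mat4
    commutator g h =
      ((StabE.mat g ⊗ StabE.mat h) ⊗ StabE.inv g) ⊗ StabE.inv h

    -- G = commutator subgroup of the stabilizer: the elements of PGL(4,q)
    -- that are (projectively) finite products of commutators
    prodComm : List (StabE × StabE) → Mat4
    prodComm = foldr (λ { (g , h) M → commutator g h ⊗ M }) idM

    InG : Mat4 → Set
    InG M = Σ (List (StabE × StabE)) λ cs → M ∝m prodComm cs

    InK : Mat4 → Set
    InK M = InG M × (U₃ ∝v (M ·m U₃))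

    -- A subgroup of K of order n, leaving 𝓛‴ invariant: a list of n
    -- pairwise projectively distinct elements of K containing the identity
    -- and closed under multiplication (a finite such subset of a group is
    -- a subgroup).
    record InvariantSubgroupOfK (n : ℕ) : Set where
      field
        elems     : List Mat4
        size      : length elems ≡ n
        distinct  : AllPairs (λ A B → ¬ (A ∝m B)) elems
        hasId     : Σ Mat4 λ C → C ∈ elems × (idM ∝m C)
        closed    : ∀ A B → A ∈ elems → B ∈ elems →
                    Σ Mat4 λ C → C ∈ elems × ((A ⊗ B) ∝m C)
        inK       : All InK elems
        invariant : All (λ M → LeavesInvariant M 𝓛‴) elems

{-# OPTIONS --safe #-}
-- The subgroup consists of the q²(q+1) projective maps N · τ(α/N, β/N) · ρ(z): τ(a, b) runs over the
-- q² elations of E with centre U₃, and ρ(z), for z = p + r√ω ∈ GF(q²)* modulo GF(q)* and N = z z̄,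
-- acts as z² on X₁ + X₂√ω and as N on X₃ and X₄. Each of them is a product of two commutators of
-- elements of the stabiliser of E and fixes U₃. Each multiplies Q by a non-zero square and X₄ by a
-- non-zero scalar, so it preserves E, every E_λ, O_s, π₀ and π₁, hence the numbers of points of a
-- line in these sets, and these numbers decide membership in 𝓛‴.
module Submission where

open import Level using (0ℓ)
open import Algebra.Bundles using (CommutativeRing; RawRing)
open import Algebra.Structures using (IsCommutativeRing)
open import Data.Bool using (Bool; true; false; T; if_then_else_; not; _∧_)
open import Data.Bool.Properties using (T-≡; ⇔→≡)
open import Data.Empty using (⊥-elim)
open import Data.Fin using (Fin; zero; suc; #_)
open import Data.Integer as ℤ using (ℤ; -[1+_])
import Data.Integer.Properties as ℤ
open import Data.List using (List; []; _∷_; _++_; map; length; cartesianProduct)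
open import Data.List.Properties using (length-++; length-map)
open import Data.List.Membership.Propositional using (_∈_; lose)
open import Data.List.Membership.Propositional.Properties
  using (∈-map⁺; ∈-map⁻; ∈-++⁺ˡ; ∈-++⁺ʳ; ∈-cartesianProduct⁺)
import Data.List.Relation.Unary.Any as Any
open import Data.List.Relation.Unary.Any using (here)
open import Data.List.Relation.Unary.Any.Properties using (any⁺; any⁻)
open import Data.List.Relation.Unary.All as All using (All)
import Data.List.Relation.Unary.All.Properties as All
open import Data.List.Relation.Unary.AllPairs as AllPairs using (AllPairs)
import Data.List.Relation.Unary.AllPairs.Properties as AllPairs
open import Data.List.Relation.Unary.Unique.Propositional using (Unique)
import Data.List.Relation.Unary.Unique.Propositional.Properties as Unique
open import Data.Maybe using (Maybe; just; nothing)
open import Data.Maybe.Properties using (just-injective)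
open import Data.Nat as ℕ using (ℕ; zero; suc)
import Data.Nat.Properties as ℕ
open import Data.Product using (Σ; _×_; _,_)
open import Data.Sign as Sign using (Sign)
open import Data.Sum using (_⊎_)
open import Data.Vec using (Vec; []; _∷_)
open import Function using (_∘_; _⇔_; mk⇔; Equivalence)
open import Function.Properties.Equivalence using () renaming (trans to ⇔-trans; sym to ⇔-sym)
open import Relation.Binary.PropositionalEquality
open import Relation.Nullary using (¬_; yes; no; does)
open import Relation.Nullary.Decidable using (dec-true; does-⇔)

open import Defs

pattern 0F = zero
pattern 1F = suc zero
pattern 2F = suc (suc zero)
pattern 3F = suc (suc (suc zero))

-- The library solver takes its coefficients from the ring itself, whose arithmetic does not compute
-- here; normalising with integer coefficients makes equal polynomials have identical normal forms.
module IntegerCoefficientSolver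
  {A : Set} {add mul : A → A → A} {neg : A → A} {0ᴬ 1ᴬ : A}
  (isCommutativeRing : IsCommutativeRing _≡_ add mul neg 0ᴬ 1ᴬ) where

  open import Tactic.RingSolver.Core.AlmostCommutativeRing
    using (AlmostCommutativeRing; fromCommutativeRing)
  open import Tactic.RingSolver.Core.Polynomial.Parameters using (Homomorphism)
  open import Tactic.RingSolver.Core.Expression public
    renaming (_⊕_ to _:+_; _⊗_ to _:*_; ⊝_ to :-_)

  commutativeRing : CommutativeRing 0ℓ 0ℓ
  commutativeRing = record { isCommutativeRing = isCommutativeRing }

  open CommutativeRing commutativeRing
    using (_+_; _*_; -_; 0#; 1#; semiring; +-assoc; +-comm; +-identityˡ; +-identityʳ; -‿inverseʳ; *-identityˡ)
  open import Algebra.Properties.Ring (CommutativeRing.ring commutativeRing)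
    using (-0#≈0#; -‿involutive; -‿distribˡ-*; -‿distribʳ-*)
  open import Algebra.Properties.AbelianGroup (CommutativeRing.+-abelianGroup commutativeRing)
    using (⁻¹-∙-comm)
  open import Algebra.Properties.Semiring.Mult.TCOptimised semiring
    using (×-homo-+; ×1-homo-*) renaming (_×_ to _×ₙ_)
  open ≡-Reasoning

  ⟦_⟧ℤ : ℤ → A
  ⟦ ℤ.+ n ⟧ℤ = n ×ₙ 1#
  ⟦ -[1+ n ] ⟧ℤ = - (suc n ×ₙ 1#)

  private
    suc×1 : ∀ n → suc n ×ₙ 1# ≡ 1# + n ×ₙ 1#
    suc×1 n = ×-homo-+ 1# 1 n

    signed : Sign → A → A
    signed Sign.+ x = x
    signed Sign.- x = - x

    ⟦⟧ℤ-signAbs : ∀ i → ⟦ i ⟧ℤ ≡ signed (ℤ.sign i) (ℤ.∣ i ∣ ×ₙ 1#)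
    ⟦⟧ℤ-signAbs (ℤ.+ n) = refl
    ⟦⟧ℤ-signAbs -[1+ n ] = refl

    ⟦◃⟧ : ∀ s n → ⟦ s ℤ.◃ n ⟧ℤ ≡ signed s (n ×ₙ 1#)
    ⟦◃⟧ Sign.+ zero = refl
    ⟦◃⟧ Sign.- zero = sym -0#≈0#
    ⟦◃⟧ Sign.+ (suc n) = refl
    ⟦◃⟧ Sign.- (suc n) = refl

    signed-* : ∀ s t x y → signed (s Sign.* t) (x * y) ≡ signed s x * signed t y
    signed-* Sign.+ Sign.+ x y = refl
    signed-* Sign.+ Sign.- x y = -‿distribʳ-* x y
    signed-* Sign.- Sign.+ x y = -‿distribˡ-* x y
    signed-* Sign.- Sign.- x y = begin
      x * y         ≡⟨ sym (-‿involutive (x * y)) ⟩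
      - - (x * y)   ≡⟨ cong -_ (-‿distribˡ-* x y) ⟩
      - (- x * y)   ≡⟨ -‿distribʳ-* (- x) y ⟩
      - x * - y     ∎

    1+x-[1+y] : ∀ x y → (1# + x) + - (1# + y) ≡ x + - y
    1+x-[1+y] x y = begin
      (1# + x) + - (1# + y)    ≡⟨ cong₂ _+_ (+-comm 1# x) (sym (⁻¹-∙-comm 1# y)) ⟩
      (x + 1#) + (- 1# + - y)  ≡⟨ +-assoc x 1# (- 1# + - y) ⟩
      x + (1# + (- 1# + - y))  ≡⟨ cong (x +_) (sym (+-assoc 1# (- 1#) (- y))) ⟩
      x + ((1# + - 1#) + - y)  ≡⟨ cong (λ z → x + (z + - y)) (-‿inverseʳ 1#) ⟩
      x + (0# + - y)           ≡⟨ cong (x +_) (+-identityˡ (- y)) ⟩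
      x + - y                  ∎

    ⟦⊖⟧ : ∀ m n → ⟦ m ℤ.⊖ n ⟧ℤ ≡ m ×ₙ 1# + - (n ×ₙ 1#)
    ⟦⊖⟧ m zero = begin
      m ×ₙ 1#           ≡⟨ sym (+-identityʳ (m ×ₙ 1#)) ⟩
      m ×ₙ 1# + 0#      ≡⟨ cong (m ×ₙ 1# +_) (sym -0#≈0#) ⟩
      m ×ₙ 1# + - 0#    ∎
    ⟦⊖⟧ zero (suc n) = sym (+-identityˡ _)
    ⟦⊖⟧ (suc m) (suc n) = begin
      ⟦ suc m ℤ.⊖ suc n ⟧ℤ                    ≡⟨ cong ⟦_⟧ℤ (ℤ.[1+m]⊖[1+n]≡m⊖n m n) ⟩
      ⟦ m ℤ.⊖ n ⟧ℤ                            ≡⟨ ⟦⊖⟧ m n ⟩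
      m ×ₙ 1# + - (n ×ₙ 1#)                     ≡⟨ sym (1+x-[1+y] (m ×ₙ 1#) (n ×ₙ 1#)) ⟩
      (1# + m ×ₙ 1#) + - (1# + n ×ₙ 1#)         ≡⟨ cong₂ (λ x y → x + - y) (sym (suc×1 m)) (sym (suc×1 n)) ⟩
      suc m ×ₙ 1# + - (suc n ×ₙ 1#)             ∎

  ⟦⟧ℤ-+ : ∀ i j → ⟦ i ℤ.+ j ⟧ℤ ≡ ⟦ i ⟧ℤ + ⟦ j ⟧ℤ
  ⟦⟧ℤ-+ (ℤ.+ m) (ℤ.+ n) = ×-homo-+ 1# m n
  ⟦⟧ℤ-+ (ℤ.+ m) -[1+ n ] = ⟦⊖⟧ m (suc n)
  ⟦⟧ℤ-+ -[1+ m ] (ℤ.+ n) = trans (⟦⊖⟧ n (suc m)) (+-comm (n ×ₙ 1#) _)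
  ⟦⟧ℤ-+ -[1+ m ] -[1+ n ] = begin
    - (suc (suc (m ℕ.+ n)) ×ₙ 1#)            ≡⟨ cong (λ k → - (suc k ×ₙ 1#)) (sym (ℕ.+-suc m n)) ⟩
    - ((suc m ℕ.+ suc n) ×ₙ 1#)              ≡⟨ cong -_ (×-homo-+ 1# (suc m) (suc n)) ⟩
    - (suc m ×ₙ 1# + suc n ×ₙ 1#)             ≡⟨ sym (⁻¹-∙-comm _ _) ⟩
    - (suc m ×ₙ 1#) + - (suc n ×ₙ 1#)         ∎

  ⟦⟧ℤ-* : ∀ i j → ⟦ i ℤ.* j ⟧ℤ ≡ ⟦ i ⟧ℤ * ⟦ j ⟧ℤ
  ⟦⟧ℤ-* i j = begin
    ⟦ s ℤ.◃ ℤ.∣ i ∣ ℕ.* ℤ.∣ j ∣ ⟧ℤ                          ≡⟨ ⟦◃⟧ s (ℤ.∣ i ∣ ℕ.* ℤ.∣ j ∣) ⟩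
    signed s ((ℤ.∣ i ∣ ℕ.* ℤ.∣ j ∣) ×ₙ 1#)                   ≡⟨ cong (signed s) (×1-homo-* ℤ.∣ i ∣ ℤ.∣ j ∣) ⟩
    signed s (ℤ.∣ i ∣ ×ₙ 1# * ℤ.∣ j ∣ ×ₙ 1#)                   ≡⟨ signed-* (ℤ.sign i) (ℤ.sign j) _ _ ⟩
    signed (ℤ.sign i) (ℤ.∣ i ∣ ×ₙ 1#) * signed (ℤ.sign j) (ℤ.∣ j ∣ ×ₙ 1#)
                                                            ≡⟨ sym (cong₂ _*_ (⟦⟧ℤ-signAbs i) (⟦⟧ℤ-signAbs j)) ⟩
    ⟦ i ⟧ℤ * ⟦ j ⟧ℤ                                          ∎
    where s = ℤ.sign i Sign.* ℤ.sign j

  ⟦⟧ℤ-neg : ∀ i → ⟦ ℤ.- i ⟧ℤ ≡ - ⟦ i ⟧ℤ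
  ⟦⟧ℤ-neg (ℤ.+ zero) = sym -0#≈0#
  ⟦⟧ℤ-neg (ℤ.+ suc n) = refl
  ⟦⟧ℤ-neg -[1+ n ] = sym (-‿involutive _)

  private
    isZeroℤ : ℤ → Bool
    isZeroℤ (ℤ.+ zero) = true
    isZeroℤ _ = false

    isZeroℤ-sound : ∀ i → T (isZeroℤ i) → 0# ≡ ⟦ i ⟧ℤ
    isZeroℤ-sound (ℤ.+ zero) _ = refl

    almostCommutativeRing : AlmostCommutativeRing 0ℓ 0ℓ
    almostCommutativeRing = fromCommutativeRing commutativeRing (λ _ → nothing)

    homomorphism : Homomorphism 0ℓ 0ℓ 0ℓ 0ℓ
    homomorphism = record
      { from = record { rawRing = CommutativeRing.rawRing ℤ.+-*-commutativeRing ; isZero = isZeroℤ }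
      ; to = almostCommutativeRing
      ; morphism = record
          { ⟦_⟧ = ⟦_⟧ℤ ; +-homo = ⟦⟧ℤ-+ ; *-homo = ⟦⟧ℤ-* ; -‿homo = ⟦⟧ℤ-neg ; 0-homo = refl ; 1-homo = refl }
      ; Zero-C⟶Zero-R = isZeroℤ-sound
      }

  open import Tactic.RingSolver.Core.Polynomial.Base (Homomorphism.from homomorphism)
  open import Tactic.RingSolver.Core.Polynomial.Semantics homomorphism renaming (⟦_⟧ to ⟦_⟧ₚ)
  open import Tactic.RingSolver.Core.Polynomial.Homomorphism homomorphism
  open Eval (AlmostCommutativeRing.rawRing almostCommutativeRing) ⟦_⟧ℤ public

  normalise : ∀ {n} → Expr ℤ n → Poly n
  normalise (Κ x) = κ x
  normalise (Ι x) = ι x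
  normalise (x :+ y) = normalise x ⊞ normalise y
  normalise (x :* y) = normalise x ⊠ normalise y
  normalise (:- x) = ⊟ normalise x
  normalise (x ⊛ i) = normalise x ⊡ i

  ⟦_⇓⟧ : ∀ {n} → Expr ℤ n → Vec A n → A
  ⟦ e ⇓⟧ ρ = ⟦ normalise e ⟧ₚ ρ

  normalise-correct : ∀ {n} (e : Expr ℤ n) ρ → ⟦ e ⇓⟧ ρ ≡ ⟦ e ⟧ ρ
  normalise-correct (Κ x) ρ = κ-hom x ρ
  normalise-correct (Ι x) ρ = ι-hom x ρ
  normalise-correct (x :+ y) ρ = trans (⊞-hom (normalise x) (normalise y) ρ) (cong₂ _+_ (normalise-correct x ρ) (normalise-correct y ρ))
  normalise-correct (x :* y) ρ = trans (⊠-hom (normalise x) (normalise y) ρ) (cong₂ _*_ (normalise-correct x ρ) (normalise-correct y ρ))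
  normalise-correct (:- x) ρ = trans (⊟-hom (normalise x) ρ) (cong -_ (normalise-correct x ρ))
  normalise-correct (x ⊛ i) ρ = trans (⊡-hom (normalise x) i ρ) (cong (λ z → AlmostCommutativeRing._^_ almostCommutativeRing z i) (normalise-correct x ρ))

  open import Relation.Binary.Reflection (setoid A) Ι ⟦_⟧ ⟦_⇓⟧ normalise-correct public
    using (prove; solve; _⊜_)

  0̂ 1̂ : ∀ {n} → Expr ℤ n
  0̂ = Κ (ℤ.+ 0)
  1̂ = Κ (ℤ.+ 1)

  exprRawRing : ℕ → RawRing 0ℓ 0ℓ
  exprRawRing n = record
    { Carrier = Expr ℤ n ; _≈_ = _≡_ ; _+_ = _:+_ ; _*_ = _:*_ ; -_ = :-_
    ; 0# = 0̂ ; 1# = 1̂ }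

-- Stated over any raw ring so that, instantiated at expressions, evaluating a formula applied to
-- variables gives back the same formula applied to their values, definitionally.
module QuadricFormulas (R : RawRing 0ℓ 0ℓ) (ω : RawRing.Carrier R) where

  open RawRing R

  Point : Set
  Point = Fin 4 → Carrier

  Matrix : Set
  Matrix = Fin 4 → Fin 4 → Carrier

  infixl 7 _⊙_ _·_
  infixr 8 _∙_
  infix 4 _≋_

  _≋_ : Matrix → Matrix → Set
  M ≋ N = ∀ i j → M i j ≡ N i j

  sum₄ : (Fin 4 → Carrier) → Carrier
  sum₄ f = f 0F + f 1F + f 2F + f 3F

  _⊙_ : Matrix → Matrix → Matrix
  (M ⊙ N) i k = sum₄ (λ j → M i j * N j k)

  _·_ : Matrix → Point → Point
  (M · x) i = sum₄ (λ j → M i j * x j)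

  _∙_ : Carrier → Matrix → Matrix
  (c ∙ M) i j = c * M i j

  Q : Point → Carrier
  Q x = x 0F * x 0F + - (ω * (x 1F * x 1F)) + x 2F * x 3F

  point : Carrier → Carrier → Carrier → Carrier → Point
  point a b c d 0F = a
  point a b c d 1F = b
  point a b c d 2F = c
  point a b c d 3F = d

  double : Carrier → Carrier
  double x = (1# + 1#) * x

  -- For z = p + r√ω in GF(q²): norm = z z̄, and z² = re² + im² √ω.
  norm re² im² : Carrier → Carrier → Carrier
  norm p r = p * p + - (ω * (r * r))
  re² p r = p * p + ω * (r * r)
  im² p r = double (p * r)

  block : (a b c d e f : Carrier) → Matrix
  block a b c d e f 0F 0F = a
  block a b c d e f 0F 1F = b
  block a b c d e f 1F 0F = c
  block a b c d e f 1F 1F = d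
  block a b c d e f 2F 2F = e
  block a b c d e f 3F 3F = f
  block a b c d e f 0F 2F = 0#
  block a b c d e f 0F 3F = 0#
  block a b c d e f 1F 2F = 0#
  block a b c d e f 1F 3F = 0#
  block a b c d e f 2F 0F = 0#
  block a b c d e f 2F 1F = 0#
  block a b c d e f 2F 3F = 0#
  block a b c d e f 3F 0F = 0#
  block a b c d e f 3F 1F = 0#
  block a b c d e f 3F 2F = 0#

  identity negate-X₃X₄ negate-X₂ : Matrix
  identity = block 1# 0# 0# 1# 1# 1#
  negate-X₃X₄ = block 1# 0# 0# 1# (- 1#) (- 1#)
  negate-X₂ = block 1# 0# 0# (- 1#) 1# 1#

  -- multiplication by z = p + r√ω on X₁ + X₂√ω, and by z z̄ on X₃
  multiply adjugate : Carrier → Carrier → Matrix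
  multiply p r = block p (ω * r) r p (norm p r) 1#
  adjugate p r = block p (- (ω * r)) (- r) p 1# (norm p r)

  translation : Carrier → Carrier → Matrix
  translation a b 0F 0F = 1#
  translation a b 0F 1F = 0#
  translation a b 0F 2F = 0#
  translation a b 0F 3F = a
  translation a b 1F 0F = 0#
  translation a b 1F 1F = 1#
  translation a b 1F 2F = 0#
  translation a b 1F 3F = b
  translation a b 2F 0F = - double a
  translation a b 2F 1F = double (ω * b)
  translation a b 2F 2F = 1#
  translation a b 2F 3F = - norm a b
  translation a b 3F 0F = 0#
  translation a b 3F 1F = 0#
  translation a b 3F 2F = 0#
  translation a b 3F 3F = 1#

  -- multiplication by z² on X₁ + X₂√ω, by z z̄ on X₃ and X₄
  rotation : Carrier → Carrier → Matrix
  rotation p r = block (re² p r) (ω * im² p r) (im² p r) (re² p r) (norm p r) (norm p r)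

  -- N · translation (α/N) (β/N) ⊙ rotation p r, with N = norm p r, cleared of denominators
  element : Carrier → Carrier → Carrier → Carrier → Matrix
  element α β p r 0F 0F = re² p r * norm p r
  element α β p r 0F 1F = ω * im² p r * norm p r
  element α β p r 0F 2F = 0#
  element α β p r 0F 3F = α * norm p r
  element α β p r 1F 0F = im² p r * norm p r
  element α β p r 1F 1F = re² p r * norm p r
  element α β p r 1F 2F = 0#
  element α β p r 1F 3F = β * norm p r
  element α β p r 2F 0F = - double (α * re² p r) + double (ω * β * im² p r)
  element α β p r 2F 1F = double (ω * β * re² p r) + - double (ω * α * im² p r)
  element α β p r 2F 2F = norm p r * norm p r
  element α β p r 2F 3F = - norm α β
  element α β p r 3F 0F = 0#
  element α β p r 3F 1F = 0#
  element α β p r 3F 2F = 0#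
  element α β p r 3F 3F = norm p r * norm p r

module Entrywise where

  All⁴ : (Fin 4 → Set) → Set
  All⁴ P = P 0F × P 1F × P 2F × P 3F

  All⁴ˣ⁴ : (Fin 4 → Fin 4 → Set) → Set
  All⁴ˣ⁴ P = All⁴ (λ i → All⁴ (P i))

  pattern refl⁴ = refl , refl , refl , refl
  pattern refl⁴ˣ⁴ = refl⁴ , refl⁴ , refl⁴ , refl⁴

  map⁴ : ∀ {P R : Fin 4 → Set} → (∀ {i} → P i → R i) → All⁴ P → All⁴ R
  map⁴ f (a , b , c , d) = f a , f b , f c , f d

  lookup⁴ : ∀ {P : Fin 4 → Set} → All⁴ P → ∀ i → P i
  lookup⁴ (a , b , c , d) 0F = a
  lookup⁴ (a , b , c , d) 1F = b
  lookup⁴ (a , b , c , d) 2F = c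
  lookup⁴ (a , b , c , d) 3F = d

  lookup⁴ˣ⁴ : ∀ {P : Fin 4 → Fin 4 → Set} → All⁴ˣ⁴ P → ∀ i j → P i j
  lookup⁴ˣ⁴ {P} h i = lookup⁴ {P i} (lookup⁴ {λ i → All⁴ (P i)} h i)

module Identities (𝔽 : FiniteField) (ω : FiniteField.Carrier 𝔽) where

  open FiniteField 𝔽
  open IntegerCoefficientSolver isCommutativeRing
  open QuadricFormulas (CommutativeRing.rawRing commutativeRing) ω public
  open Entrywise

  private
    -- ω is always variable 0
    module Symbolic (n : ℕ) = QuadricFormulas (exprRawRing (suc n)) (Ι zero)

    matrix-identity : ∀ {n} (ρ : Vec Carrier n) (L R : Fin 4 → Fin 4 → Expr ℤ n) →
      All⁴ˣ⁴ (λ i j → ⟦ L i j ⇓⟧ ρ ≡ ⟦ R i j ⇓⟧ ρ) → All⁴ˣ⁴ (λ i j → ⟦ L i j ⟧ ρ ≡ ⟦ R i j ⟧ ρ)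
    matrix-identity ρ L R = map⁴ (λ {i} → map⁴ (λ {j} → prove ρ (L i j) (R i j)))

  ⊙-cong : ∀ {M M′ N N′} → M ≋ M′ → N ≋ N′ → M ⊙ N ≋ M′ ⊙ N′
  ⊙-cong {M} {M′} {N} {N′} M≋M′ N≋N′ i k = cong₂ _+_ (cong₂ _+_ (cong₂ _+_ (entry 0F) (entry 1F)) (entry 2F)) (entry 3F)
    where
    entry : ∀ j → M i j * N j k ≡ M′ i j * N′ j k
    entry j = cong₂ _*_ (M≋M′ i j) (N≋N′ j k)

  ⊙-identityʳ : ∀ M → M ⊙ idM 𝔽 ≋ M
  ⊙-identityʳ M i = lookup⁴ (map⁴ (λ {k} → prove (ω ∷ M i 0F ∷ M i 1F ∷ M i 2F ∷ M i 3F ∷ [])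
    (S.sum₄ (λ j → row j :* S.identity j k)) (row k)) refl⁴)
    where
    module S = Symbolic 4
    row = S.point (Ι (# 1)) (Ι (# 2)) (Ι (# 3)) (Ι (# 4))

  ⊙-∙ʳ : ∀ M c N → M ⊙ c ∙ N ≋ c ∙ (M ⊙ N)
  ⊙-∙ʳ M c N i k = prove (ω ∷ c ∷ M i 0F ∷ M i 1F ∷ M i 2F ∷ M i 3F ∷ N 0F k ∷ N 1F k ∷ N 2F k ∷ N 3F k ∷ [])
    (S.sum₄ (λ j → row j :* (Ι (# 1) :* column j))) (Ι (# 1) :* S.sum₄ (λ j → row j :* column j)) refl
    where
    module S = Symbolic 9
    row = S.point (Ι (# 2)) (Ι (# 3)) (Ι (# 4)) (Ι (# 5))
    column = S.point (Ι (# 6)) (Ι (# 7)) (Ι (# 8)) (Ι (# 9))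

  element-⊙ : ∀ α β p r α′ β′ p′ r′ →
    element α β p r ⊙ element α′ β′ p′ r′ ≋
    element (α * norm p′ r′ + re² p r * α′ + ω * im² p r * β′)
            (β * norm p′ r′ + im² p r * α′ + re² p r * β′)
            (p * p′ + ω * r * r′) (p * r′ + r * p′)
  element-⊙ α β p r α′ β′ p′ r′ = lookup⁴ˣ⁴ (matrix-identity (ω ∷ α ∷ β ∷ p ∷ r ∷ α′ ∷ β′ ∷ p′ ∷ r′ ∷ [])
    (S.element a b x y S.⊙ S.element a′ b′ x′ y′)
    (S.element (a :* S.norm x′ y′ :+ S.re² x y :* a′ :+ Ι zero :* S.im² x y :* b′)
               (b :* S.norm x′ y′ :+ S.im² x y :* a′ :+ S.re² x y :* b′)
               (x :* x′ :+ Ι zero :* y :* y′) (x :* y′ :+ y :* x′))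
    refl⁴ˣ⁴)
    where
    module S = Symbolic 8
    a = Ι (# 1); b = Ι (# 2); x = Ι (# 3); y = Ι (# 4)
    a′ = Ι (# 5); b′ = Ι (# 6); x′ = Ι (# 7); y′ = Ι (# 8)

  element-homogeneous : ∀ t α β p r →
    element (t * t * α) (t * t * β) (t * p) (t * r) ≋ (t * t * (t * t)) ∙ element α β p r
  element-homogeneous t α β p r = lookup⁴ˣ⁴ (matrix-identity (ω ∷ t ∷ α ∷ β ∷ p ∷ r ∷ [])
    (S.element (s :* s :* a) (s :* s :* b) (s :* x) (s :* y))
    ((s :* s :* (s :* s)) S.∙ S.element a b x y)
    refl⁴ˣ⁴)
    where
    module S = Symbolic 5
    s = Ι (# 1); a = Ι (# 2); b = Ι (# 3); x = Ι (# 4); y = Ι (# 5)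

  element-identity : element 0# 0# 1# 0# ≋ idM 𝔽
  element-identity = lookup⁴ˣ⁴ (matrix-identity (ω ∷ [])
    (S.element (0̂) (0̂) (1̂) (0̂)) S.identity refl⁴ˣ⁴)
    where module S = Symbolic 0

  element-fixes-U₃ : ∀ α β p r i → (element α β p r · U₃ 𝔽) i ≡ (norm p r * norm p r) * U₃ 𝔽 i
  element-fixes-U₃ α β p r = lookup⁴ (map⁴ (λ {i} → prove (ω ∷ α ∷ β ∷ p ∷ r ∷ [])
    ((S.element a b x y S.· u₃) i) ((S.norm x y :* S.norm x y) :* u₃ i)) refl⁴)
    where
    module S = Symbolic 4
    a = Ι (# 1); b = Ι (# 2); x = Ι (# 3); y = Ι (# 4)
    u₃ = S.point (0̂) (0̂) (1̂) (0̂)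

  Q-element : ∀ α β p r z →
    Q (element α β p r · z) ≡ (norm p r * norm p r) * (norm p r * norm p r) * Q z
  Q-element α β p r z = prove (ω ∷ α ∷ β ∷ p ∷ r ∷ z 0F ∷ z 1F ∷ z 2F ∷ z 3F ∷ [])
    (S.Q (S.element a b x y S.· ẑ)) ((S.norm x y :* S.norm x y) :* (S.norm x y :* S.norm x y) :* S.Q ẑ) refl
    where
    module S = Symbolic 8
    a = Ι (# 1); b = Ι (# 2); x = Ι (# 3); y = Ι (# 4)
    ẑ = S.point (Ι (# 5)) (Ι (# 6)) (Ι (# 7)) (Ι (# 8))

  X₄-element : ∀ α β p r z → (element α β p r · z) 3F ≡ (norm p r * norm p r) * z 3F
  X₄-element α β p r z = prove (ω ∷ α ∷ β ∷ p ∷ r ∷ z 0F ∷ z 1F ∷ z 2F ∷ z 3F ∷ [])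
    ((S.element a b x y S.· ẑ) 3F) ((S.norm x y :* S.norm x y) :* Ι (# 8)) refl
    where
    module S = Symbolic 8
    a = Ι (# 1); b = Ι (# 2); x = Ι (# 3); y = Ι (# 4)
    ẑ = S.point (Ι (# 5)) (Ι (# 6)) (Ι (# 7)) (Ι (# 8))

  Q-negate-X₃X₄ : ∀ z → Q (negate-X₃X₄ · z) ≡ 1# * Q z
  Q-negate-X₃X₄ z = prove (ω ∷ z 0F ∷ z 1F ∷ z 2F ∷ z 3F ∷ [])
    (S.Q (S.negate-X₃X₄ S.· ẑ)) (1̂ :* S.Q ẑ) refl
    where
    module S = Symbolic 4
    ẑ = S.point (Ι (# 1)) (Ι (# 2)) (Ι (# 3)) (Ι (# 4))

  Q-negate-X₂ : ∀ z → Q (negate-X₂ · z) ≡ 1# * Q z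
  Q-negate-X₂ z = prove (ω ∷ z 0F ∷ z 1F ∷ z 2F ∷ z 3F ∷ [])
    (S.Q (S.negate-X₂ S.· ẑ)) (1̂ :* S.Q ẑ) refl
    where
    module S = Symbolic 4
    ẑ = S.point (Ι (# 1)) (Ι (# 2)) (Ι (# 3)) (Ι (# 4))

  Q-translation : ∀ a b z → Q (translation a b · z) ≡ 1# * Q z
  Q-translation a b z = prove (ω ∷ a ∷ b ∷ z 0F ∷ z 1F ∷ z 2F ∷ z 3F ∷ [])
    (S.Q (S.translation (Ι (# 1)) (Ι (# 2)) S.· ẑ)) (1̂ :* S.Q ẑ) refl
    where
    module S = Symbolic 6
    ẑ = S.point (Ι (# 3)) (Ι (# 4)) (Ι (# 5)) (Ι (# 6))

  Q-multiply : ∀ p r z → Q (multiply p r · z) ≡ norm p r * Q z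
  Q-multiply p r z = prove (ω ∷ p ∷ r ∷ z 0F ∷ z 1F ∷ z 2F ∷ z 3F ∷ [])
    (S.Q (S.multiply x y S.· ẑ)) (S.norm x y :* S.Q ẑ) refl
    where
    module S = Symbolic 6
    x = Ι (# 1); y = Ι (# 2)
    ẑ = S.point (Ι (# 3)) (Ι (# 4)) (Ι (# 5)) (Ι (# 6))

  negate-X₃X₄-involutive : negate-X₃X₄ ⊙ negate-X₃X₄ ≋ idM 𝔽
  negate-X₃X₄-involutive = lookup⁴ˣ⁴ (matrix-identity (ω ∷ [])
    (S.negate-X₃X₄ S.⊙ S.negate-X₃X₄) S.identity refl⁴ˣ⁴)
    where module S = Symbolic 0

  negate-X₂-involutive : negate-X₂ ⊙ negate-X₂ ≋ idM 𝔽
  negate-X₂-involutive = lookup⁴ˣ⁴ (matrix-identity (ω ∷ [])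
    (S.negate-X₂ S.⊙ S.negate-X₂) S.identity refl⁴ˣ⁴)
    where module S = Symbolic 0

  translation-inverseʳ : ∀ a b → translation a b ⊙ translation (- a) (- b) ≋ idM 𝔽
  translation-inverseʳ a b = lookup⁴ˣ⁴ (matrix-identity (ω ∷ a ∷ b ∷ [])
    (S.translation (Ι (# 1)) (Ι (# 2)) S.⊙ S.translation (:- Ι (# 1)) (:- Ι (# 2)))
    S.identity refl⁴ˣ⁴)
    where module S = Symbolic 2

  translation-inverseˡ : ∀ a b → translation (- a) (- b) ⊙ translation a b ≋ idM 𝔽
  translation-inverseˡ a b = lookup⁴ˣ⁴ (matrix-identity (ω ∷ a ∷ b ∷ [])
    (S.translation (:- Ι (# 1)) (:- Ι (# 2)) S.⊙ S.translation (Ι (# 1)) (Ι (# 2)))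
    S.identity refl⁴ˣ⁴)
    where module S = Symbolic 2

  multiply-adjugate : ∀ p r k → multiply p r ⊙ k ∙ adjugate p r ≋ (k * norm p r) ∙ idM 𝔽
  multiply-adjugate p r k = lookup⁴ˣ⁴ (matrix-identity (ω ∷ p ∷ r ∷ k ∷ [])
    (S.multiply x y S.⊙ Ι (# 3) S.∙ S.adjugate x y) ((Ι (# 3) :* S.norm x y) S.∙ S.identity) refl⁴ˣ⁴)
    where
    module S = Symbolic 3
    x = Ι (# 1); y = Ι (# 2)

  adjugate-multiply : ∀ p r k → k ∙ adjugate p r ⊙ multiply p r ≋ (k * norm p r) ∙ idM 𝔽
  adjugate-multiply p r k = lookup⁴ˣ⁴ (matrix-identity (ω ∷ p ∷ r ∷ k ∷ [])
    (Ι (# 3) S.∙ S.adjugate x y S.⊙ S.multiply x y) ((Ι (# 3) :* S.norm x y) S.∙ S.identity) refl⁴ˣ⁴)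
    where
    module S = Symbolic 3
    x = Ι (# 1); y = Ι (# 2)

  commutator-negate-X₃X₄-translation : ∀ a b →
    negate-X₃X₄ ⊙ translation a b ⊙ negate-X₃X₄ ⊙ translation (- a) (- b) ≋ translation (- double a) (- double b)
  commutator-negate-X₃X₄-translation a b = lookup⁴ˣ⁴ (matrix-identity (ω ∷ a ∷ b ∷ [])
    (S.negate-X₃X₄ S.⊙ S.translation (Ι (# 1)) (Ι (# 2)) S.⊙ S.negate-X₃X₄ S.⊙ S.translation (:- Ι (# 1)) (:- Ι (# 2)))
    (S.translation (:- S.double (Ι (# 1))) (:- S.double (Ι (# 2)))) refl⁴ˣ⁴)
    where module S = Symbolic 2

  commutator-multiply-negate-X₂ : ∀ p r k →
    multiply p r ⊙ negate-X₂ ⊙ k ∙ adjugate p r ⊙ negate-X₂ ≋ k ∙ rotation p r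
  commutator-multiply-negate-X₂ p r k = lookup⁴ˣ⁴ (matrix-identity (ω ∷ p ∷ r ∷ k ∷ [])
    (S.multiply x y S.⊙ S.negate-X₂ S.⊙ Ι (# 3) S.∙ S.adjugate x y S.⊙ S.negate-X₂)
    (Ι (# 3) S.∙ S.rotation x y) refl⁴ˣ⁴)
    where
    module S = Symbolic 3
    x = Ι (# 1); y = Ι (# 2)

  element-factorisation : ∀ a b p r →
    element (norm p r * a) (norm p r * b) p r ≋ norm p r ∙ (translation a b ⊙ rotation p r)
  element-factorisation a b p r = lookup⁴ˣ⁴ (matrix-identity (ω ∷ a ∷ b ∷ p ∷ r ∷ [])
    (S.element (S.norm x y :* Ι (# 1)) (S.norm x y :* Ι (# 2)) x y)
    (S.norm x y S.∙ (S.translation (Ι (# 1)) (Ι (# 2)) S.⊙ S.rotation x y)) refl⁴ˣ⁴)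
    where
    module S = Symbolic 4
    x = Ι (# 3); y = Ι (# 4)

  corner-gap-element : ∀ α β p r →
    element α β p r 0F 0F + - element α β p r 3F 3F ≡ double (ω * (r * r)) * norm p r
  corner-gap-element α β p r = prove (ω ∷ α ∷ β ∷ p ∷ r ∷ [])
    (S.element a b x y 0F 0F :+ :- S.element a b x y 3F 3F) (S.double (Ι zero :* (y :* y)) :* S.norm x y) refl
    where
    module S = Symbolic 4
    a = Ι (# 1); b = Ι (# 2); x = Ι (# 3); y = Ι (# 4)

  norm-* : ∀ p r p′ r′ → norm (p * p′ + ω * r * r′) (p * r′ + r * p′) ≡ norm p r * norm p′ r′
  norm-* p r p′ r′ = prove (ω ∷ p ∷ r ∷ p′ ∷ r′ ∷ [])
    (S.norm (x :* x′ :+ Ι zero :* y :* y′) (x :* y′ :+ y :* x′)) (S.norm x y :* S.norm x′ y′) refl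
    where
    module S = Symbolic 4
    x = Ι (# 1); y = Ι (# 2); x′ = Ι (# 3); y′ = Ι (# 4)

module FieldFacts (𝔽 : FiniteField) where

  open FiniteField 𝔽
  open IntegerCoefficientSolver isCommutativeRing using (commutativeRing)
  open CommutativeRing commutativeRing using (*-comm; *-assoc; *-identityˡ; *-identityʳ; zeroʳ)

  ⁻¹-inverseˡ : ∀ {x} → ¬ x ≡ 0# → x ⁻¹ * x ≡ 1#
  ⁻¹-inverseˡ {x} x≢0 = trans (*-comm (x ⁻¹) x) (inverse x x≢0)

  *-cancelˡ : ∀ {x y z} → ¬ x ≡ 0# → x * y ≡ x * z → y ≡ z
  *-cancelˡ {x} {y} {z} x≢0 xy≡xz = begin
    y                ≡⟨ sym (*-identityˡ y) ⟩
    1# * y           ≡⟨ cong (_* y) (sym (⁻¹-inverseˡ x≢0)) ⟩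
    x ⁻¹ * x * y     ≡⟨ *-assoc (x ⁻¹) x y ⟩
    x ⁻¹ * (x * y)   ≡⟨ cong (x ⁻¹ *_) xy≡xz ⟩
    x ⁻¹ * (x * z)   ≡⟨ sym (*-assoc (x ⁻¹) x z) ⟩
    x ⁻¹ * x * z     ≡⟨ cong (_* z) (⁻¹-inverseˡ x≢0) ⟩
    1# * z           ≡⟨ *-identityˡ z ⟩
    z                ∎
    where open ≡-Reasoning

  *-≢0 : ∀ {x y} → ¬ x ≡ 0# → ¬ y ≡ 0# → ¬ x * y ≡ 0#
  *-≢0 {x} x≢0 y≢0 xy≡0 = y≢0 (*-cancelˡ x≢0 (trans xy≡0 (sym (zeroʳ x))))

  x≡c*x⇒c≡1 : ∀ {x c} → ¬ x ≡ 0# → x ≡ c * x → c ≡ 1#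
  x≡c*x⇒c≡1 {x} {c} x≢0 x≡cx = *-cancelˡ x≢0 (trans (*-comm x c) (trans (sym x≡cx) (sym (*-identityʳ x))))

  ⁻¹-≢0 : ∀ {x} → ¬ x ≡ 0# → ¬ x ⁻¹ ≡ 0#
  ⁻¹-≢0 {x} x≢0 x⁻¹≡0 = 1≢0 (trans (sym (inverse x x≢0)) (trans (cong (x *_) x⁻¹≡0) (zeroʳ x)))

  isZero⇒≡0 : ∀ {x} → isZero 𝔽 x ≡ true → x ≡ 0#
  isZero⇒≡0 {x} h with x ≟ 0#
  ... | yes x≡0 = x≡0

  ≡0⇒isZero : ∀ {x} → x ≡ 0# → isZero 𝔽 x ≡ true
  ≡0⇒isZero {x} = dec-true (x ≟ 0#)

  isZero-*ˡ : ∀ c x → ¬ c ≡ 0# → isZero 𝔽 (c * x) ≡ isZero 𝔽 x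
  isZero-*ˡ c x c≢0 = does-⇔ (mk⇔ (λ cx≡0 → *-cancelˡ c≢0 (trans cx≡0 (sym (zeroʳ c))))
                                  (λ x≡0 → trans (cong (c *_) x≡0) (zeroʳ c)))
                             ((c * x) ≟ 0#) (x ≟ 0#)

  IsSquare : Carrier → Set
  IsSquare x = Σ Carrier λ y → y * y ≡ x

  isSquare⇔IsSquare : ∀ x → isSquare 𝔽 x ≡ true ⇔ IsSquare x
  isSquare⇔IsSquare x = mk⇔ sound complete′
    where
    test : Carrier → Bool
    test y = does ((y * y) ≟ x)
    sound : isSquare 𝔽 x ≡ true → IsSquare x
    sound h with Any.satisfied (any⁻ test elements (Equivalence.from T-≡ h))
    ... | y , t with (y * y) ≟ x
    ...   | yes y²≡x = y , y²≡x
    complete′ : IsSquare x → isSquare 𝔽 x ≡ true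
    complete′ (y , y²≡x) = Equivalence.to T-≡
      (any⁺ test (lose {P = T ∘ test} (complete y) (Equivalence.from T-≡ (dec-true ((y * y) ≟ x) y²≡x))))

  IsSquare-*ˡ : ∀ d x → ¬ d ≡ 0# → IsSquare (d * d * x) ⇔ IsSquare x
  IsSquare-*ˡ d x d≢0 = mk⇔
    (λ (y , y²≡d²x) → y * d ⁻¹ , *-cancelˡ (*-≢0 d≢0 d≢0) (begin
      d * d * (y * d ⁻¹ * (y * d ⁻¹))     ≡⟨ rearrange d (d ⁻¹) y ⟩
      (d ⁻¹ * d) * (d ⁻¹ * d) * (y * y)   ≡⟨ cong₂ (λ e s → e * e * s) (⁻¹-inverseˡ d≢0) y²≡d²x ⟩
      1# * 1# * (d * d * x)              ≡⟨ cong (_* (d * d * x)) (*-identityˡ 1#) ⟩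
      1# * (d * d * x)                   ≡⟨ *-identityˡ _ ⟩
      d * d * x                          ∎))
    (λ (y , y²≡x) → d * y , trans (rearrange′ d y) (cong (d * d *_) y²≡x))
    where
    open ≡-Reasoning
    open IntegerCoefficientSolver isCommutativeRing using (solve; _⊜_; _:*_)
    rearrange : ∀ a b y → a * a * (y * b * (y * b)) ≡ (b * a) * (b * a) * (y * y)
    rearrange = solve 3 (λ a b y → a :* a :* (y :* b :* (y :* b)) ⊜ (b :* a) :* (b :* a) :* (y :* y)) refl
    rearrange′ : ∀ a y → a * y * (a * y) ≡ a * a * (y * y)
    rearrange′ = solve 2 (λ a y → a :* y :* (a :* y) ⊜ a :* a :* (y :* y)) refl

  isSquare-*ˡ : ∀ d x → ¬ d ≡ 0# → isSquare 𝔽 (d * d * x) ≡ isSquare 𝔽 x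
  isSquare-*ˡ d x d≢0 = ⇔→≡ (⇔-trans (isSquare⇔IsSquare (d * d * x))
                                  (⇔-trans (IsSquare-*ˡ d x d≢0) (⇔-sym (isSquare⇔IsSquare x))))

module LineClassInvariance (𝔽 : FiniteField) (ω λ₁ λ₂ : FiniteField.Carrier 𝔽) where

  open FiniteField 𝔽
  open Setting 𝔽 ω λ₁ λ₂ hiding (Q)
  open Identities 𝔽 ω using (Matrix; Point; _·_; Q)
  open FieldFacts 𝔽
  open IntegerCoefficientSolver isCommutativeRing using (solve; _⊜_; _:+_; _:*_)

  record IsSimilarity (M : Matrix) : Set where
    field
      multiplier    : Carrier
      multiplier≢0  : ¬ multiplier ≡ 0#
      Q-·           : ∀ z → Q (M · z) ≡ multiplier * multiplier * Q z
      X₄-·          : ∀ z → X₄ 𝔽 (M · z) ≡ multiplier * X₄ 𝔽 z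

  -- stated up to pointwise equality of points, as there is no function extensionality
  Preserves : Matrix → (Point → Bool) → Set
  Preserves M P = ∀ x z → (∀ i → x i ≡ (M · z) i) → P x ≡ P z

  Q-cong : ∀ {x z : Point} → (∀ i → x i ≡ z i) → Q x ≡ Q z
  Q-cong x≗z = cong₂ _+_ (cong₂ _+_ (cong₂ _*_ (x≗z 0F) (x≗z 0F)) (cong (λ w → - (ω * (w * w))) (x≗z 1F)))
                         (cong₂ _*_ (x≗z 2F) (x≗z 3F))

  ·-linear : ∀ (M : Matrix) u v t i → (M · (_+v_ 𝔽 u (_·v_ 𝔽 t v))) i ≡ (M · u) i + t * (M · v) i
  ·-linear M u v t i = solve 13 (λ m₀ m₁ m₂ m₃ u₀ u₁ u₂ u₃ v₀ v₁ v₂ v₃ t →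
      m₀ :* (u₀ :+ t :* v₀) :+ m₁ :* (u₁ :+ t :* v₁) :+ m₂ :* (u₂ :+ t :* v₂) :+ m₃ :* (u₃ :+ t :* v₃)
    ⊜ (m₀ :* u₀ :+ m₁ :* u₁ :+ m₂ :* u₂ :+ m₃ :* u₃) :+ t :* (m₀ :* v₀ :+ m₁ :* v₁ :+ m₂ :* v₂ :+ m₃ :* v₃)) refl
    (M i 0F) (M i 1F) (M i 2F) (M i 3F) (u 0F) (u 1F) (u 2F) (u 3F) (v 0F) (v 1F) (v 2F) (v 3F) t

  countB-cong : ∀ {A : Set} (f g : A → Bool) → (∀ a → f a ≡ g a) → ∀ as → countB 𝔽 f as ≡ countB 𝔽 g as
  countB-cong f g f≗g [] = refl
  countB-cong f g f≗g (a ∷ as) = cong₂ (λ b n → (if b then 1 else 0) ℕ.+ n) (f≗g a) (countB-cong f g f≗g as)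

  countOnLine-· : ∀ M P → Preserves M P → ∀ u v → countOnLine 𝔽 P (M · u) (M · v) ≡ countOnLine 𝔽 P u v
  countOnLine-· M P M-preserves-P u v =
    cong₂ (λ b n → (if b then 1 else 0) ℕ.+ n) (M-preserves-P (M · v) v (λ _ → refl))
          (countB-cong _ _ (λ t → M-preserves-P _ (_+v_ 𝔽 u (_·v_ 𝔽 t v)) (λ i → sym (·-linear M u v t i))) elements)

  module _ {M : Matrix} (similar : IsSimilarity M) where

    open IsSimilarity similar renaming (multiplier to d; multiplier≢0 to d≢0)

    private
      d²≢0 : ¬ d * d ≡ 0#
      d²≢0 = *-≢0 d≢0 d≢0

      module _ (x z : Point) (x≗Mz : ∀ i → x i ≡ (M · z) i) where

        Q-scaled : Q x ≡ d * d * Q z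
        Q-scaled = trans (Q-cong x≗Mz) (Q-· z)

        isZero-Q : isZero 𝔽 (Q x) ≡ isZero 𝔽 (Q z)
        isZero-Q = trans (cong (isZero 𝔽) Q-scaled) (isZero-*ˡ (d * d) (Q z) d²≢0)

        isSquare-Q : isSquare 𝔽 (Q x) ≡ isSquare 𝔽 (Q z)
        isSquare-Q = trans (cong (isSquare 𝔽) Q-scaled) (isSquare-*ˡ d (Q z) d≢0)

        isZero-X₄ : isZero 𝔽 (X₄ 𝔽 x) ≡ isZero 𝔽 (X₄ 𝔽 z)
        isZero-X₄ = trans (cong (isZero 𝔽) (trans (x≗Mz 3F) (X₄-· z))) (isZero-*ˡ d (X₄ 𝔽 z) d≢0)

        isZero-Eλ : ∀ λ′ → isZero 𝔽 (Q x + λ′ * (X₄ 𝔽 x * X₄ 𝔽 x)) ≡ isZero 𝔽 (Q z + λ′ * (X₄ 𝔽 z * X₄ 𝔽 z))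
        isZero-Eλ λ′ = trans (cong (isZero 𝔽) (begin
            Q x + λ′ * (X₄ 𝔽 x * X₄ 𝔽 x)
              ≡⟨ cong₂ (λ q w → q + λ′ * (w * w)) Q-scaled (trans (x≗Mz 3F) (X₄-· z)) ⟩
            d * d * Q z + λ′ * (d * X₄ 𝔽 z * (d * X₄ 𝔽 z))
              ≡⟨ solve 4 (λ d q l w → d :* d :* q :+ l :* (d :* w :* (d :* w)) ⊜ d :* d :* (q :+ l :* (w :* w))) refl d (Q z) λ′ (X₄ 𝔽 z) ⟩
            d * d * (Q z + λ′ * (X₄ 𝔽 z * X₄ 𝔽 z)) ∎))
          (isZero-*ˡ (d * d) _ d²≢0)
          where open ≡-Reasoning

    preserves-onE : Preserves M onE
    preserves-onE = isZero-Q

    preserves-onEλ : ∀ λ′ → Preserves M (onEλ λ′)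
    preserves-onEλ λ′ x z x≗Mz = isZero-Eλ x z x≗Mz λ′

    preserves-inOs : Preserves M inOs
    preserves-inOs x z x≗Mz = cong₂ (λ a b → not a ∧ b) (isZero-Q x z x≗Mz) (isSquare-Q x z x≗Mz)

    preserves-inπ₀ : Preserves M inπ₀
    preserves-inπ₀ x z x≗Mz =
      cong₂ _∧_ (isZero-X₄ x z x≗Mz) (cong₂ (λ a b → not a ∧ b) (isZero-Q x z x≗Mz) (isSquare-Q x z x≗Mz))

    preserves-inπ₁ : Preserves M inπ₁
    preserves-inπ₁ x z x≗Mz = cong₂ (λ a b → a ∧ not b) (isZero-X₄ x z x≗Mz) (isSquare-Q x z x≗Mz)

  Profile : Set
  Profile = ℕ × ℕ × ℕ × ℕ × ℕ × ℕ

  profile : Point → Point → Profile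
  profile u v = countOnLine 𝔽 onE u v , countOnLine 𝔽 inOs u v , countOnLine 𝔽 (onEλ λ₁) u v ,
                countOnLine 𝔽 (onEλ λ₂) u v , countOnLine 𝔽 inπ₀ u v , countOnLine 𝔽 inπ₁ u v

  -- 𝓛‴ u v unfolds to In𝓛‴ (profile u v)
  In𝓛‴ : Profile → Set
  In𝓛‴ (e , s , e₁ , e₂ , p₀ , p₁) =
    ((((e ≡ 1) × (s ≡ order)) ⊎ (e ≡ 0)) ×
       ¬ (((e ≡ 0) × (e₁ ≡ 1) × (p₁ ≡ 1)) ⊎ ((e ≡ 0) × (e₂ ≡ 1) × (p₀ ≡ 1))))
    ⊎ (((e ≡ 2) × (e₁ ≡ 1) × (p₀ ≡ 1)) ⊎ ((e ≡ 2) × (e₂ ≡ 1) × (p₁ ≡ 1)))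

  profile-· : ∀ {M} → IsSimilarity M → ∀ u v → profile (M · u) (M · v) ≡ profile u v
  profile-· {M} similar u v =
    cong₂ _,_ (countOnLine-· M onE (preserves-onE similar) u v)
    (cong₂ _,_ (countOnLine-· M inOs (preserves-inOs similar) u v)
    (cong₂ _,_ (countOnLine-· M (onEλ λ₁) (preserves-onEλ similar λ₁) u v)
    (cong₂ _,_ (countOnLine-· M (onEλ λ₂) (preserves-onEλ similar λ₂) u v)
    (cong₂ _,_ (countOnLine-· M inπ₀ (preserves-inπ₀ similar) u v)
               (countOnLine-· M inπ₁ (preserves-inπ₁ similar) u v)))))

  similarity-leaves-𝓛‴-invariant : ∀ {M} → IsSimilarity M → LeavesInvariant 𝔽 M 𝓛‴
  similarity-leaves-𝓛‴-invariant similar u v _ u,v∈𝓛‴ =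
    subst In𝓛‴ (sym (profile-· similar u v)) u,v∈𝓛‴

module ProjectiveEquality (𝔽 : FiniteField) where

  open FiniteField 𝔽
  open FieldFacts 𝔽
  open IntegerCoefficientSolver isCommutativeRing using (commutativeRing)
  open CommutativeRing commutativeRing using (*-assoc; *-identityˡ)

  private
    _∝_ : Mat4 𝔽 → Mat4 𝔽 → Set
    _∝_ = _∝m_ 𝔽

  ≋⇒∝ : ∀ {A B : Mat4 𝔽} → (∀ i j → B i j ≡ A i j) → A ∝ B
  ≋⇒∝ B≋A = 1# , 1≢0 , λ i j → trans (B≋A i j) (sym (*-identityˡ _))

  ∝-sym : ∀ {A B} → A ∝ B → B ∝ A
  ∝-sym {A} {B} (c , c≢0 , B≋cA) = c ⁻¹ , ⁻¹-≢0 c≢0 , λ i j → begin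
    A i j                ≡⟨ sym (*-identityˡ (A i j)) ⟩
    1# * A i j           ≡⟨ cong (_* A i j) (sym (⁻¹-inverseˡ c≢0)) ⟩
    c ⁻¹ * c * A i j     ≡⟨ *-assoc (c ⁻¹) c (A i j) ⟩
    c ⁻¹ * (c * A i j)   ≡⟨ cong (c ⁻¹ *_) (sym (B≋cA i j)) ⟩
    c ⁻¹ * B i j         ∎
    where open ≡-Reasoning

  ∝-trans : ∀ {A B C} → A ∝ B → B ∝ C → A ∝ C
  ∝-trans {A} {B} {C} (c , c≢0 , B≋cA) (d , d≢0 , C≋dB) = d * c , *-≢0 d≢0 c≢0 , λ i j → begin
    C i j                ≡⟨ C≋dB i j ⟩
    d * B i j            ≡⟨ cong (d *_) (B≋cA i j) ⟩
    d * (c * A i j)      ≡⟨ sym (*-assoc d c (A i j)) ⟩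
    d * c * A i j        ∎
    where open ≡-Reasoning

module ElementsOfK (𝔽 : FiniteField) (odd : FiniteField.OddCharacteristic 𝔽)
                   (ω λ₁ λ₂ : FiniteField.Carrier 𝔽) where

  open FiniteField 𝔽
  open Setting 𝔽 ω λ₁ λ₂
  open Identities 𝔽 ω hiding (Q)
  open FieldFacts 𝔽
  open ProjectiveEquality 𝔽
  open LineClassInvariance 𝔽 ω λ₁ λ₂ using (similarity-leaves-𝓛‴-invariant)
  open IntegerCoefficientSolver isCommutativeRing using (commutativeRing; solve; _⊜_; _:+_; _:*_; :-_; 0̂; 1̂)
  open CommutativeRing commutativeRing using (*-assoc; *-identityˡ; zeroʳ)

  stabiliser : ∀ (M M⁻¹ : Matrix) c → M ⊙ M⁻¹ ≋ idM 𝔽 → M⁻¹ ⊙ M ≋ idM 𝔽 →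
               (∀ z → Q (M · z) ≡ c * Q z) → StabE
  stabiliser M M⁻¹ c M⊙M⁻¹≋I M⁻¹⊙M≋I Q-M = record
    { mat = M ; inv = M⁻¹ ; rinv = M⊙M⁻¹≋I ; linv = M⁻¹⊙M≋I
    ; preserv = λ x _ x∈E → ≡0⇒isZero (trans (Q-M x) (trans (cong (c *_) (isZero⇒≡0 x∈E)) (zeroʳ c))) }

  ≋-∙-unit : ∀ {M c} → c ≡ 1# → M ≋ c ∙ idM 𝔽 → M ≋ idM 𝔽
  ≋-∙-unit c≡1 M≋cI i j = trans (M≋cI i j) (trans (cong (_* idM 𝔽 i j) c≡1) (*-identityˡ _))

  negate-X₃X₄ˢ negate-X₂ˢ : StabE
  negate-X₃X₄ˢ = stabiliser negate-X₃X₄ negate-X₃X₄ 1# negate-X₃X₄-involutive negate-X₃X₄-involutive Q-negate-X₃X₄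
  negate-X₂ˢ = stabiliser negate-X₂ negate-X₂ 1# negate-X₂-involutive negate-X₂-involutive Q-negate-X₂

  translationˢ : Carrier → Carrier → StabE
  translationˢ a b = stabiliser (translation a b) (translation (- a) (- b)) 1#
    (translation-inverseʳ a b) (translation-inverseˡ a b) (Q-translation a b)

  multiplyˢ : ∀ p r k → k * norm p r ≡ 1# → StabE
  multiplyˢ p r k kN≡1 = stabiliser (multiply p r) (k ∙ adjugate p r) (norm p r)
    (≋-∙-unit kN≡1 (multiply-adjugate p r k)) (≋-∙-unit kN≡1 (adjugate-multiply p r k)) (Q-multiply p r)

  ½ : Carrier
  ½ = (1# + 1#) ⁻¹

  -- translation a b is the commutator of negate-X₃X₄ and translation (-a/2) (-b/2)
  double-½ : ∀ a → - double (- (½ * a)) ≡ a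
  double-½ a = begin
    - double (- (½ * a))    ≡⟨ solve 2 (λ h a → :- ((1̂ :+ 1̂) :* :- (h :* a))
                                             ⊜ (1̂ :+ 1̂) :* h :* a) refl ½ a ⟩
    (1# + 1#) * ½ * a       ≡⟨ cong (_* a) (inverse (1# + 1#) odd) ⟩
    1# * a                  ≡⟨ *-identityˡ a ⟩
    a                       ∎
    where open ≡-Reasoning

  commutators : ∀ (a b p r k : Carrier) → k * norm p r ≡ 1# → List (StabE × StabE)
  commutators a b p r k kN≡1 =
    (negate-X₃X₄ˢ , translationˢ (- (½ * a)) (- (½ * b))) ∷ (multiplyˢ p r k kN≡1 , negate-X₂ˢ) ∷ []

  prodComm-commutators : ∀ a b p r k (kN≡1 : k * norm p r ≡ 1#) →
    prodComm (commutators a b p r k kN≡1) ≋ k ∙ (translation a b ⊙ rotation p r)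
  prodComm-commutators a b p r k kN≡1 i j = begin
    prodComm (commutators a b p r k kN≡1) i j
      ≡⟨ ⊙-cong (commutator-negate-X₃X₄-translation (- (½ * a)) (- (½ * b))) second-commutator i j ⟩
    (translation (- double (- (½ * a))) (- double (- (½ * b))) ⊙ k ∙ rotation p r) i j
      ≡⟨ cong₂ (λ a′ b′ → (translation a′ b′ ⊙ k ∙ rotation p r) i j) (double-½ a) (double-½ b) ⟩
    (translation a b ⊙ k ∙ rotation p r) i j
      ≡⟨ ⊙-∙ʳ (translation a b) k (rotation p r) i j ⟩
    (k ∙ (translation a b ⊙ rotation p r)) i j ∎
    where
    open ≡-Reasoning
    commutator₂ = multiply p r ⊙ negate-X₂ ⊙ k ∙ adjugate p r ⊙ negate-X₂
    second-commutator : commutator₂ ⊙ idM 𝔽 ≋ k ∙ rotation p r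
    second-commutator i′ j′ = trans (⊙-identityʳ commutator₂ i′ j′) (commutator-multiply-negate-X₂ p r k i′ j′)

  module _ (α β p r : Carrier) (N≢0 : ¬ norm p r ≡ 0#) where

    private
      k = norm p r ⁻¹
      kN≡1 : k * norm p r ≡ 1#
      kN≡1 = ⁻¹-inverseˡ N≢0

      norm*[k*x]≡x : ∀ x → norm p r * (k * x) ≡ x
      norm*[k*x]≡x x = trans (sym (*-assoc _ k x)) (trans (cong (_* x) (inverse _ N≢0)) (*-identityˡ x))

      element∝translation⊙rotation : _∝m_ 𝔽 (element α β p r) (translation (k * α) (k * β) ⊙ rotation p r)
      element∝translation⊙rotation = ∝-sym (norm p r , N≢0 , λ i j →
        trans (cong₂ (λ a b → element a b p r i j) (sym (norm*[k*x]≡x α)) (sym (norm*[k*x]≡x β)))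
              (element-factorisation (k * α) (k * β) p r i j))

    element∈G : InG (element α β p r)
    element∈G = commutators (k * α) (k * β) p r k kN≡1 ,
      ∝-trans element∝translation⊙rotation (k , ⁻¹-≢0 N≢0 , prodComm-commutators (k * α) (k * β) p r k kN≡1)

    element∈K : InK (element α β p r)
    element∈K = element∈G , norm p r * norm p r , *-≢0 N≢0 N≢0 , element-fixes-U₃ α β p r

    element-leaves-𝓛‴-invariant : LeavesInvariant 𝔽 (element α β p r) 𝓛‴
    element-leaves-𝓛‴-invariant = similarity-leaves-𝓛‴-invariant {element α β p r} (record
      { multiplier = norm p r * norm p r ; multiplier≢0 = *-≢0 N≢0 N≢0
      ; Q-· = Q-element α β p r ; X₄-· = X₄-element α β p r })

module Enumeration (𝔽 : FiniteField) where

  open FiniteField 𝔽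

  Index : Set
  Index = Carrier × Carrier × Maybe Carrier

  directions : List (Maybe Carrier)
  directions = map just elements ++ nothing ∷ []

  indices : List Index
  indices = cartesianProduct elements (cartesianProduct elements directions)

  ∈-indices : ∀ k → k ∈ indices
  ∈-indices (a , b , z) = ∈-cartesianProduct⁺ (complete a) (∈-cartesianProduct⁺ (complete b) (∈-directions z))
    where
    ∈-directions : ∀ z → z ∈ directions
    ∈-directions (just s) = ∈-++⁺ˡ (∈-map⁺ just (complete s))
    ∈-directions nothing = ∈-++⁺ʳ (map just elements) (here refl)

  length-cartesianProduct : ∀ {A B : Set} (xs : List A) (ys : List B) →
    length (cartesianProduct xs ys) ≡ length xs ℕ.* length ys
  length-cartesianProduct [] ys = refl
  length-cartesianProduct (x ∷ xs) ys =
    trans (length-++ (map (x ,_) ys)) (cong₂ ℕ._+_ (length-map (x ,_) ys) (length-cartesianProduct xs ys))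

  length-indices : length indices ≡ order ℕ.* order ℕ.* (order ℕ.+ 1)
  length-indices = begin
    length indices                                             ≡⟨ length-cartesianProduct elements _ ⟩
    order ℕ.* length (cartesianProduct elements directions)    ≡⟨ cong (order ℕ.*_) (length-cartesianProduct elements directions) ⟩
    order ℕ.* (order ℕ.* length directions)                    ≡⟨ cong (λ n → order ℕ.* (order ℕ.* n)) length-directions ⟩
    order ℕ.* (order ℕ.* (order ℕ.+ 1))                        ≡⟨ sym (ℕ.*-assoc order order (order ℕ.+ 1)) ⟩
    order ℕ.* order ℕ.* (order ℕ.+ 1)                          ∎
    where
    open ≡-Reasoning
    length-directions : length directions ≡ order ℕ.+ 1
    length-directions = trans (length-++ (map just elements)) (cong (ℕ._+ 1) (length-map just elements))

  indices-unique : Unique indices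
  indices-unique = Unique.cartesianProduct⁺ unique (Unique.cartesianProduct⁺ unique directions-unique)
    where
    directions-unique : Unique directions
    directions-unique = Unique.++⁺ (Unique.map⁺ just-injective unique) (All.[] AllPairs.∷ AllPairs.[]) disjoint
      where
      disjoint : ∀ {z} → ¬ (z ∈ map just elements × z ∈ nothing ∷ [])
      disjoint (z∈justs , here refl) with ∈-map⁻ just z∈justs
      ... | _ , _ , ()

module Parametrisation (𝔽 : FiniteField) (odd : FiniteField.OddCharacteristic 𝔽) (ω : FiniteField.Carrier 𝔽)
    (ω-nonsquare : ¬ (Σ (FiniteField.Carrier 𝔽) λ y → FiniteField._*_ 𝔽 y y ≡ ω)) where

  open FiniteField 𝔽
  open Identities 𝔽 ω
  open FieldFacts 𝔽
  open ProjectiveEquality 𝔽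
  open Enumeration 𝔽
  open IntegerCoefficientSolver isCommutativeRing using (commutativeRing; solve; _⊜_; _:+_; _:*_; :-_; 0̂; 1̂)
  open CommutativeRing commutativeRing using (*-comm; *-identityˡ; *-identityʳ; zeroʳ)

  private
    _∝_ : Matrix → Matrix → Set
    _∝_ = _∝m_ 𝔽

  -- p + r√ω up to a factor in GF(q)*: just s stands for s + √ω, nothing for 1
  pOf rOf : Maybe Carrier → Carrier
  pOf (just s) = s
  pOf nothing = 1#
  rOf (just _) = 1#
  rOf nothing = 0#

  member : Index → Matrix
  member (a , b , z) = element a b (pOf z) (rOf z)

  norm-1-0 : norm 1# 0# ≡ 1#
  norm-1-0 = solve 1 (λ w → 1̂ :* 1̂ :+ :- (w :* (0̂ :* 0̂)) ⊜ 1̂) refl ω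

  norm-direction≢0 : ∀ z → ¬ norm (pOf z) (rOf z) ≡ 0#
  norm-direction≢0 (just s) N≡0 = ω-nonsquare (s , (begin
    s * s                           ≡⟨ solve 2 (λ s w → s :* s ⊜ s :* s :+ :- (w :* (1̂ :* 1̂)) :+ w) refl s ω ⟩
    norm s 1# + ω                   ≡⟨ cong (_+ ω) N≡0 ⟩
    0# + ω                          ≡⟨ solve 1 (λ w → 0̂ :+ w ⊜ w) refl ω ⟩
    ω                               ∎))
    where open ≡-Reasoning
  norm-direction≢0 nothing N≡0 = 1≢0 (trans (sym norm-1-0) N≡0)

  element∝member : ∀ α β p r → ¬ norm p r ≡ 0# → Σ Index λ k → element α β p r ∝ member k
  element∝member α β p r N≢0 with r ≟ 0#
  ... | no r≢0 = (t * t * α , t * t * β , just (t * p)) , t * t * (t * t) , *-≢0 t²≢0 t²≢0 , λ x y →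
          trans (cong (λ r′ → element (t * t * α) (t * t * β) (t * p) r′ x y) (sym (⁻¹-inverseˡ r≢0)))
                (element-homogeneous t α β p r x y)
    where
    t = r ⁻¹
    t²≢0 = *-≢0 (⁻¹-≢0 r≢0) (⁻¹-≢0 r≢0)
  ... | yes r≡0 = (t * t * α , t * t * β , nothing) , t * t * (t * t) , *-≢0 t²≢0 t²≢0 , λ x y →
          trans (cong₂ (λ p′ r′ → element (t * t * α) (t * t * β) p′ r′ x y)
                       (sym (⁻¹-inverseˡ p≢0)) (sym (trans (cong (t *_) r≡0) (zeroʳ t))))
                (element-homogeneous t α β p r x y)
    where
    p≢0 : ¬ p ≡ 0#
    p≢0 p≡0 = N≢0 (trans (cong₂ norm p≡0 r≡0)
                         (solve 1 (λ w → 0̂ :* 0̂ :+ :- (w :* (0̂ :* 0̂)) ⊜ 0̂) refl ω))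
    t = p ⁻¹
    t²≢0 = *-≢0 (⁻¹-≢0 p≢0) (⁻¹-≢0 p≢0)

  member-⊙ : ∀ i j → Σ Index λ k → (member i ⊙ member j) ∝ member k
  member-⊙ (a , b , z) (a′ , b′ , z′) with element∝member _ _ _ _ N″≢0
    where
    N″≢0 : ¬ norm (pOf z * pOf z′ + ω * rOf z * rOf z′) (pOf z * rOf z′ + rOf z * pOf z′) ≡ 0#
    N″≢0 N″≡0 = *-≢0 (norm-direction≢0 z) (norm-direction≢0 z′) (trans (sym (norm-* _ _ _ _)) N″≡0)
  ... | k , product∝k = k , ∝-trans (≋⇒∝ (λ x y → sym (element-⊙ a b (pOf z) (rOf z) a′ b′ (pOf z′) (rOf z′) x y))) product∝k

  -- For element α β p r this is 2ωr² · norm p r: it tells the two kinds of direction apart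
  -- and recovers the norm.
  corner-gap : Matrix → Carrier
  corner-gap M = M 0F 0F + - M 3F 3F

  corner-gap-∝ : ∀ {A B} ((c , _ , B≋cA) : A ∝ B) → corner-gap B ≡ c * corner-gap A
  corner-gap-∝ {A} (c , _ , B≋cA) = trans (cong₂ (λ x y → x + - y) (B≋cA 0F 0F) (B≋cA 3F 3F))
    (solve 3 (λ c x y → c :* x :+ :- (c :* y) ⊜ c :* (x :+ :- y)) refl c (A 0F 0F) (A 3F 3F))

  double-ω≢0 : ¬ double (ω * (1# * 1#)) ≡ 0#
  double-ω≢0 = *-≢0 odd (*-≢0 ω≢0 (*-≢0 1≢0 1≢0))
    where
    ω≢0 : ¬ ω ≡ 0#
    ω≢0 ω≡0 = ω-nonsquare (0# , trans (zeroʳ 0#) (sym ω≡0))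

  corner-gap-just≢0 : ∀ a b s → ¬ corner-gap (member (a , b , just s)) ≡ 0#
  corner-gap-just≢0 a b s gap≡0 =
    *-≢0 double-ω≢0 (norm-direction≢0 (just s)) (trans (sym (corner-gap-element a b s 1#)) gap≡0)

  corner-gap-nothing : ∀ a b → corner-gap (member (a , b , nothing)) ≡ 0#
  corner-gap-nothing a b = trans (corner-gap-element a b 1# 0#)
    (solve 2 (λ w n → (1̂ :+ 1̂) :* (w :* (0̂ :* 0̂)) :* n ⊜ 0̂) refl ω (norm 1# 0#))

  same-rotation⇒same-translation : ∀ {a b a′ b′ p r} → ¬ norm p r ≡ 0# →
    element a b p r ∝ element a′ b′ p r → a ≡ a′ × b ≡ b′
  same-rotation⇒same-translation {p = p} {r} N≢0 (c , _ , B≋cA) =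
    sym (cancel-N (B≋cA 0F 3F)) , sym (cancel-N (B≋cA 1F 3F))
    where
    N = norm p r
    cancel-N : ∀ {x y} → x * N ≡ c * (y * N) → x ≡ y
    cancel-N {x} {y} xN≡cyN = *-cancelˡ N≢0 (begin
      N * x        ≡⟨ *-comm N x ⟩
      x * N        ≡⟨ xN≡cyN ⟩
      c * (y * N)  ≡⟨ cong (_* (y * N)) (x≡c*x⇒c≡1 (*-≢0 N≢0 N≢0) (B≋cA 3F 3F)) ⟩
      1# * (y * N) ≡⟨ *-identityˡ (y * N) ⟩
      y * N        ≡⟨ *-comm y N ⟩
      N * y        ∎)
      where open ≡-Reasoning

  same-direction : ∀ {a b a′ b′ s s′} → member (a , b , just s) ∝ member (a′ , b′ , just s′) → s ≡ s′
  same-direction {a} {b} {a′} {b′} {s} {s′} i∝j@(c , _ , B≋cA) =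
    sym (trans (sym (*-identityʳ s′)) (trans (*-cancelˡ odd double-s′≡double-s) (*-identityʳ s)))
    where
    open ≡-Reasoning
    N = norm s 1#
    N′ = norm s′ 1#
    g = double (ω * (1# * 1#))
    swap : ∀ x y z → x * (y * z) ≡ y * (x * z)
    swap = solve 3 (λ x y z → x :* (y :* z) ⊜ y :* (x :* z)) refl
    N′≡cN : N′ ≡ c * N
    N′≡cN = *-cancelˡ double-ω≢0 (begin
      g * N′                                ≡⟨ sym (corner-gap-element a′ b′ s′ 1#) ⟩
      corner-gap (member (a′ , b′ , just s′)) ≡⟨ corner-gap-∝ i∝j ⟩
      c * corner-gap (member (a , b , just s)) ≡⟨ cong (c *_) (corner-gap-element a b s 1#) ⟩
      c * (g * N)                           ≡⟨ swap c g N ⟩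
      g * (c * N)                           ∎)
    double-s′≡double-s : im² s′ 1# ≡ im² s 1#
    double-s′≡double-s = *-cancelˡ (norm-direction≢0 (just s′)) (begin
      N′ * im² s′ 1#        ≡⟨ *-comm N′ _ ⟩
      im² s′ 1# * N′        ≡⟨ B≋cA 1F 0F ⟩
      c * (im² s 1# * N)    ≡⟨ swap c (im² s 1#) N ⟩
      im² s 1# * (c * N)    ≡⟨ cong (im² s 1# *_) (sym N′≡cN) ⟩
      im² s 1# * N′         ≡⟨ *-comm _ N′ ⟩
      N′ * im² s 1#         ∎)

  member-injective : ∀ i j → member i ∝ member j → i ≡ j
  member-injective (a , b , just s) (a′ , b′ , just s′) i∝j with same-direction i∝j
  ... | refl with same-rotation⇒same-translation (norm-direction≢0 (just s)) i∝j
  ...   | refl , refl = refl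
  member-injective (a , b , just s) (a′ , b′ , nothing) i∝j@(c , c≢0 , _) =
    ⊥-elim (*-≢0 c≢0 (corner-gap-just≢0 a b s) (trans (sym (corner-gap-∝ i∝j)) (corner-gap-nothing a′ b′)))
  member-injective (a , b , nothing) (a′ , b′ , just s′) i∝j@(c , _ , _) =
    ⊥-elim (corner-gap-just≢0 a′ b′ s′ (trans (corner-gap-∝ i∝j) (trans (cong (c *_) (corner-gap-nothing a b)) (zeroʳ c))))
  member-injective (a , b , nothing) (a′ , b′ , nothing) i∝j
    with same-rotation⇒same-translation (norm-direction≢0 nothing) i∝j
  ... | refl , refl = refl

  members : List Matrix
  members = map member indices

  length-members : length members ≡ order ℕ.* order ℕ.* (order ℕ.+ 1)
  length-members = trans (length-map member indices) length-indices

  members-distinct : AllPairs (λ A B → ¬ A ∝ B) members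
  members-distinct = AllPairs.map⁺ (AllPairs.map (λ {i} {j} i≢j → i≢j ∘ member-injective i j) indices-unique)

  members-closed : ∀ A B → A ∈ members → B ∈ members → Σ Matrix λ C → C ∈ members × (A ⊙ B) ∝ C
  members-closed A B A∈ B∈ =
    let i , _ , A≡i = ∈-map⁻ member A∈
        j , _ , B≡j = ∈-map⁻ member B∈
        k , i⊙j∝k = member-⊙ i j
    in member k , ∈-map⁺ member (∈-indices k) , subst₂ (λ A B → (A ⊙ B) ∝ member k) (sym A≡i) (sym B≡j) i⊙j∝k

  All-members : ∀ {P : Matrix → Set} → (∀ k → P (member k)) → All P members
  All-members P-member = All.map⁺ (All.tabulate (λ {k} _ → P-member k))

open import Data.Nat using (_+_; _*_)

proposition3p10 :
  (𝔽 : FiniteField) → FiniteField.OddCharacteristic 𝔽 →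
  (ω λ₁ λ₂ : FiniteField.Carrier 𝔽) →
  ¬ (Σ (FiniteField.Carrier 𝔽) λ y → FiniteField._*_ 𝔽 y y ≡ ω) →
  ¬ (λ₁ ≡ FiniteField.0# 𝔽) →
  Σ (FiniteField.Carrier 𝔽) (λ y → FiniteField._*_ 𝔽 y y ≡ λ₁) →
  ¬ (Σ (FiniteField.Carrier 𝔽) λ y → FiniteField._*_ 𝔽 y y ≡ λ₂) →
  Setting.InvariantSubgroupOfK 𝔽 ω λ₁ λ₂
    (FiniteField.order 𝔽 * FiniteField.order 𝔽 * (FiniteField.order 𝔽 + 1))
proposition3p10 𝔽 odd ω λ₁ λ₂ ω-nonsquare _ _ _ = record
  { elems     = members
  ; size      = length-members
  ; distinct  = members-distinct
  ; hasId     = member (0# , 0# , nothing) , ∈-map⁺ member (∈-indices (0# , 0# , nothing)) , ≋⇒∝ element-identity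
  ; closed    = members-closed
  ; inK       = All-members (λ (a , b , z) → element∈K a b (pOf z) (rOf z) (norm-direction≢0 z))
  ; invariant = All-members (λ (a , b , z) → element-leaves-𝓛‴-invariant a b (pOf z) (rOf z) (norm-direction≢0 z))
  }
  where
  open FiniteField 𝔽 using (0#)
  open Identities 𝔽 ω using (element-identity)
  open ProjectiveEquality 𝔽 using (≋⇒∝)
  open Enumeration 𝔽 using (∈-indices)
  open Parametrisation 𝔽 odd ω ω-nonsquare
  open ElementsOfK 𝔽 odd ω λ₁ λ₂ using (element∈K; element-leaves-𝓛‴-invariant)
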